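{- Let $q$ be an odd prime power, $d$ a positive integer, and $\varphi_d$ the coloring defined in the context. Let $\{s_1,\ldots,s_t\} \subseteq (\mathbb{F}_q^*)^d$ be a set of $t$ linearly independent vectors, and let $a, b \in (\mathbb{F}_q^*)^d$ (with $a \neq b$ and $a, b \notin \{s_1,\ldots,s_t\}$) be such that there exist colors $\alpha, \beta \in C_d$ with $\varphi_d(a,b) = \varphi_d(a,s_i) = \alpha$ and $\varphi_d(b,s_i) = \beta$ for every $1 \leq i \leq t$. Then $s_1, \ldots, s_t, b$ are linearly independent.
   Context: $\mathbb{F}_q^*$ is the set of nonzero elements of the finite field $\mathbb{F}_q$, endowed with an arbitrary fixed linear order; $(\mathbb{F}_q^*)^d$ is ordered lexicographically with respect to it. $C_d$ is the disjoint union $\mathrm{DOT} \sqcup \mathrm{ZERO} \sqcup \mathrm{UP} \sqcup \mathrm{DOWN}$ where $\mathrm{DOT} = \mathbb{F}_q^*$ and ZERO, UP, DOWN are three disjoint copies of $\{1,\ldots,d\} \times \mathbb{F}_q$. For distinct $x<y$ in $(\mathbb{F}_q^*)^d$, with $i$ the first coordinate where $x$ and $y$ differ and $\cdot$ the standard dot product over $\mathbb{F}_q$, the symmetric coloring $\varphi_d(x,y)=\varphi_d(y,x)$ is: $(i, x_i+y_i)$ in ZERO if $x\cdot y = 0$; $(i,x_i+y_i)$ in UP if $x \cdot y \neq 0$ and $x \cdot y = x \cdot x$; $(i,x_i+y_i)$ in DOWN if $x \cdot y \notin \{0, x\cdot x\}$ and $x \cdot y = y \cdot y$; and $x \cdot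 y \in \mathrm{DOT}$ otherwise. -}

module Defs where

open import Data.Nat using (ℕ; zero; suc; _^_; _%_)
open import Data.Nat.Primality using (Prime)
open import Data.Fin using (Fin)
import Data.Fin as Fin
open import Data.Vec using (Vec; []; _∷_)
open import Data.Vec.Functional as VF using ()
open import Data.Maybe using (Maybe; just; nothing)
open import Data.Product using (Σ; _×_; _,_; ∃)
open import Function.Bundles using (_↔_)
open import Relation.Nullary using (¬_; yes; no)
open import Relation.Binary.Definitions using (DecidableEquality; tri<; tri≈; tri>)
open import Relation.Binary.Structures using (IsStrictTotalOrder)
open import Relation.Binary.PropositionalEquality using (_≡_)
open import Algebra.Structures using (IsCommutativeRing)

record OddFiniteField : Set₁ where
  field
    F       : Set
    _+_ _*_ : F → F → F
    -_      : F → F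
    0# 1#   : F
    isCommutativeRing : IsCommutativeRing _≡_ _+_ _*_ -_ 0# 1#
    1≢0     : ¬ (1# ≡ 0#)
    inverse : (x : F) → ¬ (x ≡ 0#) → Σ F (λ y → x * y ≡ 1#)
    _≟_     : DecidableEquality F
    q       : ℕ
    enum    : F ↔ Fin q
    q-prime-power : Σ ℕ (λ p → Σ ℕ (λ k → Prime p × q ≡ p ^ suc k))
    q-odd   : q % 2 ≡ 1

module Over (K : OddFiniteField) where
  open OddFiniteField K

  NonZeroVec : {d : ℕ} → Vec F d → Set
  NonZeroVec {d} x = (i : Fin d) → ¬ (Data.Vec.lookup x i ≡ 0#)

  zeroVec : {d : ℕ} → Vec F d
  zeroVec = Data.Vec.replicate _ 0#

  _⊕_ : {d : ℕ} → Vec F d → Vec F d → Vec F d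
  _⊕_ = Data.Vec.zipWith _+_

  _⊙_ : {d : ℕ} → F → Vec F d → Vec F d
  c ⊙ v = Data.Vec.map (c *_) v

  dot : {d : ℕ} → Vec F d → Vec F d → F
  dot [] [] = 0#
  dot (x ∷ xs) (y ∷ ys) = (x * y) + dot xs ys

  linComb : {n d : ℕ} → (Fin n → F) → (Fin n → Vec F d) → Vec F d
  linComb {zero}  c v = zeroVec
  linComb {suc n} c v = (c Fin.zero ⊙ v Fin.zero) ⊕ linComb (λ i → c (Fin.suc i)) (λ i → v (Fin.suc i))

  LinearlyIndependent : {n d : ℕ} → (Fin n → Vec F d) → Set
  LinearlyIndependent {n} {d} v =
    (c : Fin n → F) → linComb c v ≡ zeroVec → (i : Fin n) → c i ≡ 0#

  data Colour (d : ℕ) : Set where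
    DOT  : F → Colour d
    ZERO : Fin d → F → Colour d
    UP   : Fin d → F → Colour d
    DOWN : Fin d → F → Colour d

  firstDiff : {d : ℕ} → Vec F d → Vec F d → Maybe (Fin d × F × F)
  firstDiff [] [] = nothing
  firstDiff (x ∷ xs) (y ∷ ys) with x ≟ y
  ... | no _  = just (Fin.zero , x , y)
  ... | yes _ with firstDiff xs ys
  ...   | nothing = nothing
  ...   | just (i , a , b) = just (Fin.suc i , a , b)

  module Colouring {_<_ : F → F → Set} (ord : IsStrictTotalOrder _≡_ _<_) where
    open IsStrictTotalOrder ord using (compare)

    -- colour for lo < hi (lexicographically), i the first differing index,
    -- s = lo_i + hi_i
    colourOf : {d : ℕ} → Fin d → F → Vec F d → Vec F d → Colour d
    colourOf i s lo hi with dot lo hi ≟ 0#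
    ... | yes _ = ZERO i s
    ... | no _ with dot lo hi ≟ dot lo lo
    ...   | yes _ = UP i s
    ...   | no _ with dot lo hi ≟ dot hi hi
    ...     | yes _ = DOWN i s
    ...     | no _  = DOT (dot lo hi)

    -- φ_d(x,y); nothing exactly when x = y (where φ_d is undefined).
    -- The lexicographic order on (F_q^*)^d is decided at the first differing coordinate.
    φ : {d : ℕ} → Vec F d → Vec F d → Maybe (Colour d)
    φ x y with firstDiff x y
    ... | nothing = nothing
    ... | just (i , xi , yi) with compare xi yi
    ...   | tri< _ _ _ = just (colourOf i (xi + yi) x y)
    ...   | tri≈ _ _ _ = just (colourOf i (xi + yi) x y)
    ...   | tri> _ _ _ = just (colourOf i (xi + yi) y x)

{-# OPTIONS --safe #-}
-- The common colour α of ab and of every asᵢ yields a linear functional f (the dot product with a,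
-- or a coordinate) taking one nonzero value at b and at every sᵢ; the common colour β of every bsᵢ
-- yields a linear functional g taking one value v at every sᵢ but a different one at b. Applying f
-- to a dependency c₀ b + Σ cᵢ sᵢ = 0 gives c₀ + Σ cᵢ = 0, and then applying g gives
-- c₀ (g b - v) = 0, so c₀ = 0.
module Submission where

open import Defs
open import Data.Nat using (ℕ; _≤_)
open import Data.Fin using (Fin)
open import Data.Vec using (Vec)
open import Data.Vec.Functional using (_∷_)
open import Data.Maybe using (just)
open import Relation.Nullary using (¬_)
open import Relation.Binary.Structures using (IsStrictTotalOrder)
open import Relation.Binary.PropositionalEquality using (_≡_)

open import Algebra.Bundles using (CommutativeRing)
import Algebra.Properties.CommutativeSemigroup as CommutativeSemigroupProperties
import Algebra.Properties.Ring as RingProperties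
import Algebra.Properties.Semiring.Sum as SemiringSum
open import Data.Fin using (zero; suc)
open import Data.Nat using (zero; suc)
import Data.Vec as V
open import Data.Vec using (lookup)
open import Data.Vec.Properties
  using (lookup-zipWith; lookup-map; map-cong; map-const; map-id; zipWith-replicate₁)
open import Data.Vec.Functional using (tail)
open import Data.Product using (_×_; _,_)
open import Function using (_∘_)
open import Relation.Nullary using (yes; no)
open import Relation.Binary.Definitions using (tri<; tri≈; tri>)
open import Relation.Binary.PropositionalEquality
  using (refl; sym; trans; cong; cong₂; module ≡-Reasoning)

module _ (K : OddFiniteField) where
  open OddFiniteField K using (F; inverse; _≟_; 1≢0; isCommutativeRing)
  open Over K

  commutativeRing : CommutativeRing _ _
  commutativeRing = record { isCommutativeRing = isCommutativeRing }

  open CommutativeRing commutativeRing hiding (refl; sym; trans; zero)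
  open RingProperties ring using (+-inverseʳ-unique; -‿distribˡ-*; x[y-z]≈xy-xz; x∙y⁻¹≈ε⇒x≈y; y≈x\\z)
  open CommutativeSemigroupProperties +-commutativeSemigroup using (interchange)
  open CommutativeSemigroupProperties *-commutativeSemigroup using (x∙yz≈y∙xz)
  open SemiringSum semiring using (sum)
  open ≡-Reasoning

  x*y≡0⇒x≡0 : ∀ {x y} → ¬ y ≡ 0# → x * y ≡ 0# → x ≡ 0#
  x*y≡0⇒x≡0 {x} {y} y≢0 xy≡0 with inverse y y≢0
  ... | y⁻¹ , yy⁻¹≡1 = begin
    x              ≡⟨ *-identityʳ x ⟨
    x * 1#         ≡⟨ cong (x *_) yy⁻¹≡1 ⟨
    x * (y * y⁻¹)  ≡⟨ *-assoc x y y⁻¹ ⟨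
    x * y * y⁻¹    ≡⟨ cong (_* y⁻¹) xy≡0 ⟩
    0# * y⁻¹       ≡⟨ zeroˡ y⁻¹ ⟩
    0#             ∎

  leading-coefficient-zero : ∀ {c₀ S A B v} → ¬ A ≡ 0# → ¬ B ≡ v →
                             c₀ * A + S * A ≡ 0# → c₀ * B + S * v ≡ 0# → c₀ ≡ 0#
  leading-coefficient-zero {c₀} {S} {A} {B} {v} A≢0 B≢v onA onB =
    x*y≡0⇒x≡0 (B≢v ∘ x∙y⁻¹≈ε⇒x≈y B v) (begin
      c₀ * (B - v)       ≡⟨ x[y-z]≈xy-xz c₀ B v ⟩
      c₀ * B - c₀ * v    ≡⟨ cong (c₀ * B +_) (-‿distribˡ-* c₀ v) ⟩
      c₀ * B + - c₀ * v  ≡⟨ cong (λ z → c₀ * B + z * v) S≡-c₀ ⟨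
      c₀ * B + S * v     ≡⟨ onB ⟩
      0#                 ∎)
    where
      S≡-c₀ : S ≡ - c₀
      S≡-c₀ = +-inverseʳ-unique c₀ S (x*y≡0⇒x≡0 A≢0 (trans (distribʳ A c₀ S) onA))

  0⊙v≡zeroVec : ∀ {d} (v : Vec F d) → 0# ⊙ v ≡ zeroVec
  0⊙v≡zeroVec v = trans (map-cong zeroˡ v) (map-const v 0#)

  zeroVec⊕v≡v : ∀ {d} (v : Vec F d) → zeroVec ⊕ v ≡ v
  zeroVec⊕v≡v v = trans (zipWith-replicate₁ _+_ 0# v) (trans (map-cong +-identityˡ v) (map-id v))

  record IsLinear {d : ℕ} (g : Vec F d → F) : Set where
    field
      ⊕-homo : ∀ u w → g (u ⊕ w) ≡ g u + g w
      ⊙-homo : ∀ c w → g (c ⊙ w) ≡ c * g w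

    zeroVec-homo : g zeroVec ≡ 0#
    zeroVec-homo = begin
      g zeroVec             ≡⟨ cong g (0⊙v≡zeroVec zeroVec) ⟨
      g (0# ⊙ zeroVec)      ≡⟨ ⊙-homo 0# zeroVec ⟩
      0# * g zeroVec        ≡⟨ zeroˡ _ ⟩
      0#                    ∎

  open IsLinear

  zero-linear : ∀ {d} → IsLinear {d} (λ _ → 0#)
  zero-linear = record { ⊕-homo = λ _ _ → sym (+-identityˡ 0#) ; ⊙-homo = λ c _ → sym (zeroʳ c) }

  lookup-linear : ∀ {d} (j : Fin d) → IsLinear (λ w → lookup w j)
  lookup-linear j = record { ⊕-homo = lookup-zipWith _+_ j ; ⊙-homo = λ c → lookup-map j (c *_) }

  dot-comm : ∀ {d} (u w : Vec F d) → dot u w ≡ dot w u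
  dot-comm V.[] V.[] = refl
  dot-comm (x V.∷ u) (y V.∷ w) = cong₂ _+_ (*-comm x y) (dot-comm u w)

  dot-linear : ∀ {d} (u : Vec F d) → IsLinear (dot u)
  dot-linear u = record { ⊕-homo = ⊕-homo′ u ; ⊙-homo = ⊙-homo′ u }
    where
      ⊕-homo′ : ∀ {d} (u v w : Vec F d) → dot u (v ⊕ w) ≡ dot u v + dot u w
      ⊕-homo′ V.[] V.[] V.[] = sym (+-identityˡ 0#)
      ⊕-homo′ (x V.∷ u) (y V.∷ v) (z V.∷ w) =
        trans (cong₂ _+_ (distribˡ x y z) (⊕-homo′ u v w)) (interchange _ _ _ _)
      ⊙-homo′ : ∀ {d} (u : Vec F d) c w → dot u (c ⊙ w) ≡ c * dot u w
      ⊙-homo′ V.[] c V.[] = sym (zeroʳ c)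
      ⊙-homo′ (x V.∷ u) c (y V.∷ w) =
        trans (cong₂ _+_ (x∙yz≈y∙xz x c y) (⊙-homo′ u c w)) (sym (distribˡ c _ _))

  linComb-constant : ∀ {n d k} {g : Vec F d → F} → IsLinear g →
                     (c : Fin n → F) (v : Fin n → Vec F d) → (∀ i → g (v i) ≡ k) →
                     g (linComb c v) ≡ sum c * k
  linComb-constant {zero} {k = k} L c v _ = trans (zeroVec-homo L) (sym (zeroˡ k))
  linComb-constant {suc n} {k = k} {g} L c v gv≡k = begin
    g ((c zero ⊙ v zero) ⊕ linComb (tail c) (tail v)) ≡⟨ ⊕-homo L _ _ ⟩
    g (c zero ⊙ v zero) + g (linComb (tail c) (tail v))
      ≡⟨ cong₂ _+_ (trans (⊙-homo L _ _) (cong (c zero *_) (gv≡k zero)))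
                   (linComb-constant L (tail c) (tail v) (gv≡k ∘ suc)) ⟩
    c zero * k + sum (tail c) * k                     ≡⟨ distribʳ k _ _ ⟨
    sum c * k                                         ∎

  dependency-image : ∀ {t d k} {g : Vec F d → F} {b : Vec F d} {s : Fin t → Vec F d} →
                     IsLinear g → (∀ i → g (s i) ≡ k) →
                     (c : Fin (suc t) → F) → linComb c (b ∷ s) ≡ zeroVec →
                     c zero * g b + sum (tail c) * k ≡ 0#
  dependency-image {k = k} {g} {b} {s} L gs≡k c dep = begin
    c zero * g b + sum (tail c) * k
      ≡⟨ cong₂ _+_ (⊙-homo L (c zero) b) (linComb-constant L (tail c) s gs≡k) ⟨
    g (c zero ⊙ b) + g (linComb (tail c) s)  ≡⟨ ⊕-homo L _ _ ⟨
    g (linComb c (b ∷ s))                    ≡⟨ cong g dep ⟩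
    g zeroVec                                ≡⟨ zeroVec-homo L ⟩
    0#                                       ∎

  ∷-independent : ∀ {t d} {b : Vec F d} {s : Fin t → Vec F d} → LinearlyIndependent s →
                  (∀ c → linComb c (b ∷ s) ≡ zeroVec → c zero ≡ 0#) →
                  LinearlyIndependent (b ∷ s)
  ∷-independent ind head≡0 c dep zero = head≡0 c dep
  ∷-independent {b = b} {s} ind head≡0 c dep (suc i) = ind (tail c) tail-dep i
    where
      tail-dep : linComb (tail c) s ≡ zeroVec
      tail-dep = begin
        linComb (tail c) s                        ≡⟨ zeroVec⊕v≡v _ ⟨
        zeroVec ⊕ linComb (tail c) s              ≡⟨ cong (_⊕ linComb (tail c) s) (0⊙v≡zeroVec b) ⟨
        (0# ⊙ b) ⊕ linComb (tail c) s             ≡⟨ cong (λ c₀ → (c₀ ⊙ b) ⊕ linComb (tail c) s) (head≡0 c dep) ⟨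
        linComb c (b ∷ s)                         ≡⟨ dep ⟩
        zeroVec                                   ∎

  record SeparatingFunctional {t d : ℕ} (b : Vec F d) (s : Fin t → Vec F d) : Set where
    field
      functional : Vec F d → F
      linear     : IsLinear functional
      value      : F
      at-s       : ∀ i → functional (s i) ≡ value
      at-b       : ¬ functional b ≡ value

  empty-separated : ∀ {d} (b : Vec F d) (s : Fin 0 → Vec F d) → SeparatingFunctional b s
  empty-separated b s = record
    { functional = λ _ → 0# ; linear = zero-linear ; value = 1# ; at-s = λ () ; at-b = 1≢0 ∘ sym }

  hyperplane-∷-independent : ∀ {t d} {f : Vec F d → F} {b : Vec F d} {s : Fin t → Vec F d} →
                             LinearlyIndependent s → IsLinear f → ¬ f b ≡ 0# →
                             (∀ i → f (s i) ≡ f b) → SeparatingFunctional b s →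
                             LinearlyIndependent (b ∷ s)
  hyperplane-∷-independent ind L fb≢0 fs≡fb sep = ∷-independent ind λ c dep →
    leading-coefficient-zero fb≢0 at-b (dependency-image L fs≡fb c dep)
                                       (dependency-image linear at-s c dep)
    where open SeparatingFunctional sep

  record AtCoordinate {d} (j : Fin d) (σ : F) (x y : Vec F d) : Set where
    constructor atCoordinate
    field
      sum≡σ : lookup x j + lookup y j ≡ σ
      x≢y   : ¬ lookup x j ≡ lookup y j

  -- Only the part of the defining conditions of a colour that the argument uses.
  Realises : ∀ {d} → Vec F d → Vec F d → Colour d → Set
  Realises x y (DOT l)    = dot x y ≡ l × ¬ l ≡ 0# × ¬ l ≡ dot x x × ¬ l ≡ dot y y
  Realises x y (ZERO j σ) = AtCoordinate j σ x y
  Realises x y (UP j σ)   = AtCoordinate j σ x y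
  Realises x y (DOWN j σ) = AtCoordinate j σ x y

  AtCoordinate-sym : ∀ {d j σ} {x y : Vec F d} → AtCoordinate j σ x y → AtCoordinate j σ y x
  AtCoordinate-sym (atCoordinate sum≡σ x≢y) = atCoordinate (trans (+-comm _ _) sum≡σ) (x≢y ∘ sym)

  Realises-sym : ∀ {d} {x y : Vec F d} γ → Realises x y γ → Realises y x γ
  Realises-sym {x = x} {y} (DOT l) (xy≡l , l≢0 , l≢xx , l≢yy) =
    trans (dot-comm y x) xy≡l , l≢0 , l≢yy , l≢xx
  Realises-sym (ZERO j σ) = AtCoordinate-sym
  Realises-sym (UP j σ)   = AtCoordinate-sym
  Realises-sym (DOWN j σ) = AtCoordinate-sym

  -- If φ(x,y) = γ then colourFunctional γ x takes at y the value colourValue γ x, which does not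
  -- depend on y.
  colourFunctional : ∀ {d} → Colour d → Vec F d → Vec F d → F
  colourFunctional (DOT _)    x = dot x
  colourFunctional (ZERO j _) _ y = lookup y j
  colourFunctional (UP j _)   _ y = lookup y j
  colourFunctional (DOWN j _) _ y = lookup y j

  colourValue : ∀ {d} → Colour d → Vec F d → F
  colourValue (DOT l)    _ = l
  colourValue (ZERO j σ) x = σ - lookup x j
  colourValue (UP j σ)   x = σ - lookup x j
  colourValue (DOWN j σ) x = σ - lookup x j

  colourFunctional-linear : ∀ {d} γ (x : Vec F d) → IsLinear (colourFunctional γ x)
  colourFunctional-linear (DOT _)    x = dot-linear x
  colourFunctional-linear (ZERO j _) _ = lookup-linear j
  colourFunctional-linear (UP j _)   _ = lookup-linear j
  colourFunctional-linear (DOWN j _) _ = lookup-linear j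

  AtCoordinate⇒value : ∀ {d j σ} {x y : Vec F d} → AtCoordinate j σ x y → lookup y j ≡ σ - lookup x j
  AtCoordinate⇒value {σ = σ} (atCoordinate sum≡σ _) = trans (y≈x\\z _ _ σ sum≡σ) (+-comm _ σ)

  AtCoordinate⇒value≢self : ∀ {d j σ} {x y : Vec F d} → AtCoordinate j σ x y →
                            ¬ σ - lookup x j ≡ lookup x j
  AtCoordinate⇒value≢self at@(atCoordinate _ x≢y) e = x≢y (sym (trans (AtCoordinate⇒value at) e))

  AtCoordinate⇒value≢0 : ∀ {d j σ} {x y : Vec F d} → NonZeroVec y → AtCoordinate j σ x y →
                         ¬ σ - lookup x j ≡ 0#
  AtCoordinate⇒value≢0 {j = j} y≢0 at e = y≢0 j (trans (AtCoordinate⇒value at) e)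

  Realises⇒colourValue : ∀ {d} {x y : Vec F d} γ → Realises x y γ →
                         colourFunctional γ x y ≡ colourValue γ x
  Realises⇒colourValue (DOT l)    (xy≡l , _) = xy≡l
  Realises⇒colourValue (ZERO j σ) = AtCoordinate⇒value
  Realises⇒colourValue (UP j σ)   = AtCoordinate⇒value
  Realises⇒colourValue (DOWN j σ) = AtCoordinate⇒value

  Realises⇒colourValue≢self : ∀ {d} {x y : Vec F d} γ → Realises x y γ →
                              ¬ colourValue γ x ≡ colourFunctional γ x x
  Realises⇒colourValue≢self (DOT l)    (_ , _ , l≢xx , _) = l≢xx
  Realises⇒colourValue≢self (ZERO j σ) = AtCoordinate⇒value≢self
  Realises⇒colourValue≢self (UP j σ)   = AtCoordinate⇒value≢self
  Realises⇒colourValue≢self (DOWN j σ) = AtCoordinate⇒value≢self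

  Realises⇒colourValue≢0 : ∀ {d} {x y : Vec F d} γ → NonZeroVec y → Realises x y γ →
                           ¬ colourValue γ x ≡ 0#
  Realises⇒colourValue≢0 (DOT l)    _ (_ , l≢0 , _) = l≢0
  Realises⇒colourValue≢0 (ZERO j σ) = AtCoordinate⇒value≢0
  Realises⇒colourValue≢0 (UP j σ)   = AtCoordinate⇒value≢0
  Realises⇒colourValue≢0 (DOWN j σ) = AtCoordinate⇒value≢0

  firstDiff⇒AtCoordinate : ∀ {d} {x y : Vec F d} {i xi yi} → firstDiff x y ≡ just (i , xi , yi) →
                           AtCoordinate i (xi + yi) x y
  firstDiff⇒AtCoordinate {x = x V.∷ xs} {y V.∷ ys} diff with x ≟ y
  ... | no x≢y with refl ← diff = atCoordinate refl x≢y
  ... | yes _ with firstDiff xs ys in diff′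
  ...   | just _ with refl ← diff with firstDiff⇒AtCoordinate {x = xs} {ys} diff′
  ...     | atCoordinate sum≡σ x≢y = atCoordinate sum≡σ x≢y

  module _ {_<_ : F → F → Set} (ord : IsStrictTotalOrder _≡_ _<_) where
    open Colouring ord
    open IsStrictTotalOrder ord using (compare)

    colourOf-realises : ∀ {d} (i : Fin d) σ (lo hi : Vec F d) → AtCoordinate i σ lo hi →
                        Realises lo hi (colourOf i σ lo hi)
    colourOf-realises i σ lo hi at with dot lo hi ≟ 0#
    ... | yes _ = at
    ... | no ≢0 with dot lo hi ≟ dot lo lo
    ...   | yes _ = at
    ...   | no ≢lo with dot lo hi ≟ dot hi hi
    ...     | yes _ = at
    ...     | no ≢hi = refl , ≢0 , ≢lo , ≢hi

    φ-realises : ∀ {d} {x y : Vec F d} {γ} → φ x y ≡ just γ → Realises x y γ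
    φ-realises {x = x} {y} e with firstDiff x y in diff
    ... | just (i , xi , yi) with compare xi yi | firstDiff⇒AtCoordinate {x = x} {y} diff
    ...   | tri< _ _ _ | at with refl ← e = colourOf-realises i _ x y at
    ...   | tri≈ _ _ _ | at with refl ← e = colourOf-realises i _ x y at
    ...   | tri> _ _ _ | at with refl ← e = Realises-sym _ (colourOf-realises i _ y x (AtCoordinate-sym at))

    same-colour-hyperplane : ∀ {t d} {x y : Vec F d} {s : Fin t → Vec F d} {γ} → NonZeroVec y →
                             φ x y ≡ just γ → (∀ i → φ x (s i) ≡ just γ) →
                             ¬ colourFunctional γ x y ≡ 0# ×
                             (∀ i → colourFunctional γ x (s i) ≡ colourFunctional γ x y)
    same-colour-hyperplane {x = x} {y} {γ = γ} y≢0 φxy φxs =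
      (λ fy≡0 → Realises⇒colourValue≢0 γ y≢0 (φ-realises φxy) (trans (sym fy≡value) fy≡0)) ,
      (λ i → trans (Realises⇒colourValue γ (φ-realises (φxs i))) (sym fy≡value))
      where
        fy≡value : colourFunctional γ x y ≡ colourValue γ x
        fy≡value = Realises⇒colourValue γ (φ-realises φxy)

    same-colour-separated : ∀ {t d} {b : Vec F d} {s : Fin t → Vec F d} {β} →
                            (∀ i → φ b (s i) ≡ just β) → SeparatingFunctional b s
    same-colour-separated {zero} {b = b} {s} _ = empty-separated b s
    same-colour-separated {suc _} {b = b} {β = β} φbs = record
      { functional = colourFunctional β b
      ; linear     = colourFunctional-linear β b
      ; value      = colourValue β b
      ; at-s       = λ i → Realises⇒colourValue β (φ-realises (φbs i))
      ; at-b       = Realises⇒colourValue≢self β (φ-realises (φbs zero)) ∘ sym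
      }

lemma5 : (K : OddFiniteField) →
    let open OddFiniteField K using (F) in
    let open Over K in
    {_<_ : F → F → Set} (ord : IsStrictTotalOrder _≡_ _<_) →
    let open Colouring ord in
    (d : ℕ) → 1 ≤ d → (t : ℕ) → (s : Fin t → Vec F d) → (a b : Vec F d) →
    ((i : Fin t) → NonZeroVec (s i)) → NonZeroVec a → NonZeroVec b →
    LinearlyIndependent s →
    ¬ (a ≡ b) → ((i : Fin t) → ¬ (a ≡ s i)) → ((i : Fin t) → ¬ (b ≡ s i)) →
    (α β : Colour d) →
    φ a b ≡ just α →
    ((i : Fin t) → φ a (s i) ≡ just α) →
    ((i : Fin t) → φ b (s i) ≡ just β) →
    LinearlyIndependent (b ∷ s)
lemma5 K ord d _ t s a b _ _ b≢0 s-independent _ _ _ α β φab≡α φas≡α φbs≡β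
  with same-colour-hyperplane K ord b≢0 φab≡α φas≡α
... | fb≢0 , fs≡fb =
  hyperplane-∷-independent K s-independent (colourFunctional-linear K α a) fb≢0 fs≡fb
    (same-colour-separated K ord φbs≡β)
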